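{- For each integer $s\ge 2$, $\mathrm{m}(K_{1,1,1,s})=3$.
   Context: $K_{1,1,1,s}$ denotes the complete $4$-partite graph with three parts of size $1$ and one part of size $s$. Given a graph $G$ and a list $L(v)$ of colors assigned to each vertex $v$, an $L$-coloring is a proper vertex coloring $c$ of $G$ with $c(v)\in L(v)$ for every vertex $v$. A graph $G$ is uniquely $k$-list colorable if there exist lists $L(v)$, each consisting of exactly $k$ colors, such that $G$ has exactly one $L$-coloring. $G$ has the property $M(k)$ if it is not uniquely $k$-list colorable. The m-number $\mathrm{m}(G)$ is the least integer $k$ such that $G$ has the property $M(k)$. -}

module Defs where

open import Data.Nat using (ℕ; _+_; _⊓_; _≤_; _<_)
open import Data.Fin using (Fin; toℕ)
open import Data.List using (List; length)
open import Data.List.Membership.Propositional using (_∈_)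
open import Data.List.Relation.Unary.Unique.Propositional using (Unique)
open import Data.Product using (Σ; _×_)
open import Relation.Nullary using (¬_)
open import Relation.Binary.PropositionalEquality using (_≡_)

record Graph : Set₁ where
  field
    n     : ℕ
    Adj   : Fin n → Fin n → Set
    sym   : ∀ {u v} → Adj u v → Adj v u
    irrefl : ∀ {v} → ¬ Adj v v
open Graph public

Color : Set
Color = ℕ

IsKListAssignment : (G : Graph) → ℕ → (Fin (n G) → List Color) → Set
IsKListAssignment G k L = ∀ v → length (L v) ≡ k × Unique (L v)

IsLColoring : (G : Graph) → (Fin (n G) → List Color) → (Fin (n G) → Color) → Set
IsLColoring G L c = (∀ v → c v ∈ L v) × (∀ u v → Adj G u v → ¬ (c u ≡ c v))

HasUniqueLColoring : (G : Graph) → (Fin (n G) → List Color) → Set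
HasUniqueLColoring G L =
  Σ (Fin (n G) → Color) λ c → IsLColoring G L c ×
    (∀ c′ → IsLColoring G L c′ → ∀ v → c′ v ≡ c v)

UniquelyListColorable : Graph → ℕ → Set
UniquelyListColorable G k =
  Σ (Fin (n G) → List Color) λ L → IsKListAssignment G k L × HasUniqueLColoring G L

PropM : Graph → ℕ → Set
PropM G k = ¬ UniquelyListColorable G k

IsMNumber : Graph → ℕ → Set
IsMNumber G m = 1 ≤ m × PropM G m × (∀ k → 1 ≤ k → k < m → ¬ PropM G k)

-- K_{1,1,1,s}: vertices Fin (3 + s); vertices 0,1,2 form singleton parts,
-- vertices 3..s+2 form the part of size s. Adjacent iff in different parts.
part : ∀ {s} → Fin (3 + s) → ℕ
part v = toℕ v ⊓ 3

K111s-Adj : ∀ s → Fin (3 + s) → Fin (3 + s) → Set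
K111s-Adj s u v = ¬ (part {s} u ≡ part {s} v)

K111s : ℕ → Graph
K111s s = record
  { n = 3 + s
  ; Adj = K111s-Adj s
  ; sym = λ h e → h (Relation.Binary.PropositionalEquality.sym e)
  ; irrefl = λ h → h Relation.Binary.PropositionalEquality.refl
  }

{-# OPTIONS --safe #-}
module Submission where

-- m(K₁,₁,₁,ₛ) ≥ 3 because every graph is uniquely 1-list colorable (give each vertex its own
-- color) and, for s ≥ 2, explicit 2-lists force a unique coloring.
--
-- For M(3), let c be the unique coloring for some 3-lists. A color of a base list that no apex
-- uses could recolor that base vertex alone, so each base list is its own color plus two apex
-- colors. Hence a new proper coloring y of the apex triangle extends to the whole graph as soon
-- as y only permutes the apex colors (keep the base colors) or shares at most one color with
-- them (give each base vertex one of its two apex colors that y avoids). Such a y always exists: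
-- if every apex list contains the color of another apex, following these choices closes a 2- or
-- 3-cycle along which the colors can be rotated; otherwise some apex has two colors unused on
-- the triangle, and then either a second apex also has one (recolor both apexes) or the other
-- two apexes can swap colors.

open import Defs hiding (sym)
open import Data.Nat using (ℕ; _≤_; s≤s; z≤n)
import Data.Nat as ℕ
open import Data.Nat.Properties using (⊓-zeroʳ; <-irrefl)
open import Data.Fin using (Fin; suc; toℕ; _↑ˡ_; _↑ʳ_; punchIn; punchOut; _≟_)
open import Data.Fin.Patterns using (0F; 1F; 2F)
open import Data.Fin.Properties using (toℕ-injective; toℕ<n; any?; punchIn-punchOut)
open import Data.Fin.Permutation
  using (Permutation′; _⟨$⟩ʳ_; _⟨$⟩ˡ_; inverseˡ; inverseʳ; flip; transpose; _∘ₚ_)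
open import Data.Vec.Functional using (_++_; updateAt)
open import Data.Vec.Functional.Properties using (lookup-++ˡ; updateAt-updates; updateAt-minimal)
open import Data.List using (List; []; _∷_; length)
open import Data.List.Membership.Propositional using (_∈_)
open import Data.List.Relation.Unary.Any using (here; there)
open import Data.List.Relation.Unary.Any.Properties using (singleton⁻)
open import Data.List.Relation.Unary.All using ([]; _∷_)
open import Data.List.Relation.Unary.AllPairs using ([]; _∷_)
open import Data.List.Relation.Unary.Unique.Propositional using (Unique)
open import Data.Product using (∃; ∃₂; _×_; _,_; proj₁; proj₂)
open import Data.Sum using (_⊎_; inj₁; inj₂)
import Data.Sum as Sum
open import Data.Empty using (⊥; ⊥-elim)
open import Function using (_∘_; const)
open import Function.Bundles using (Injection)
open import Function.Definitions using (Injective)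
open import Function.Properties.Inverse using (↔⇒↣)
open import Relation.Nullary using (¬_; yes; no)
open import Relation.Binary using (Rel; Reflexive; DecidableEquality)
open import Relation.Binary.PropositionalEquality using (_≡_; _≢_; refl; sym; trans; cong; subst)

Unblocked : (G : Graph) → (Fin (n G) → Color) → Fin (n G) → Color → Set
Unblocked G c v a = ∀ u → Adj G u v → c u ≢ a

IsUniqueLColoring : (G : Graph) → (Fin (n G) → List Color) → (Fin (n G) → Color) → Set
IsUniqueLColoring G L c = IsLColoring G L c × (∀ c′ → IsLColoring G L c′ → ∀ v → c′ v ≡ c v)

unblocked-color-is-chosen : ∀ {G L c} → IsUniqueLColoring G L c →
                            ∀ {v a} → a ∈ L v → Unblocked G c v a → a ≡ c v
unblocked-color-is-chosen {G} {L} {c} ((c∈L , c-proper) , c-unique) {v} {a} a∈Lv unblocked =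
  trans (sym (updateAt-updates v c)) (c-unique c′ (c′∈L , c′-proper) v)
  where
  c′ : Fin (n G) → Color
  c′ = updateAt c v (const a)

  c′-at : ∀ w → (w ≡ v × c′ w ≡ a) ⊎ (c′ w ≡ c w)
  c′-at w with w ≟ v
  ... | yes refl = inj₁ (refl , updateAt-updates v c)
  ... | no w≢v = inj₂ (updateAt-minimal w v c w≢v)

  c′∈L : ∀ w → c′ w ∈ L w
  c′∈L w with c′-at w
  ... | inj₁ (refl , c′v≡a) = subst (_∈ L v) (sym c′v≡a) a∈Lv
  ... | inj₂ c′w≡cw = subst (_∈ L w) (sym c′w≡cw) (c∈L w)

  c′-proper : ∀ u w → Adj G u w → c′ u ≢ c′ w
  c′-proper u w adj eq with c′-at u | c′-at w
  ... | inj₁ (refl , _) | inj₁ (refl , _) = irrefl G adj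
  ... | inj₁ (refl , eu) | inj₂ ew = unblocked w (Graph.sym G adj) (trans (sym ew) (trans (sym eq) eu))
  ... | inj₂ eu | inj₁ (refl , ew) = unblocked u adj (trans (sym eu) (trans eq ew))
  ... | inj₂ eu | inj₂ ew = c-proper u w adj (trans (sym eu) (trans eq ew))

record TwoOthers {A : Set} (l : List A) (x : A) : Set where
  constructor twoOthers
  field
    a b : A
    a∈l : a ∈ l
    b∈l : b ∈ l
    a≢b : a ≢ b
    a≢x : a ≢ x
    b≢x : b ≢ x

three-distinct⇒twoOthers : ∀ {A : Set} {l : List A} {x} →
                           length l ≡ 3 → Unique l → x ∈ l → TwoOthers l x
three-distinct⇒twoOthers {l = a ∷ b ∷ d ∷ []} refl ((a≢b ∷ a≢d ∷ []) ∷ (b≢d ∷ []) ∷ [] ∷ []) (here refl) =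
  twoOthers b d (there (here refl)) (there (there (here refl))) b≢d (a≢b ∘ sym) (a≢d ∘ sym)
three-distinct⇒twoOthers {l = a ∷ b ∷ d ∷ []} refl ((a≢b ∷ a≢d ∷ []) ∷ (b≢d ∷ []) ∷ [] ∷ []) (there (here refl)) =
  twoOthers a d (here refl) (there (there (here refl))) a≢d a≢b (b≢d ∘ sym)
three-distinct⇒twoOthers {l = a ∷ b ∷ d ∷ []} refl ((a≢b ∷ a≢d ∷ []) ∷ (b≢d ∷ []) ∷ [] ∷ []) (there (there (here refl))) =
  twoOthers a b (here refl) (there (here refl)) a≢b a≢d b≢d
three-distinct⇒twoOthers {l = _ ∷ _ ∷ _ ∷ []} refl _ (there (there (there ())))

one-of-two-avoids : ∀ {A : Set} → DecidableEquality A → ∀ {P : A → Set} {a b} →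
                    P a → P b → a ≢ b → ∀ k → ∃ λ d → P d × d ≢ k
one-of-two-avoids _≟ᴬ_ {a = a} pa pb a≢b k with a ≟ᴬ k
... | yes refl = _ , pb , a≢b ∘ sym
... | no a≢k = _ , pa , a≢k

∈-pair : ∀ {A : Set} {x a b : A} → x ∈ a ∷ b ∷ [] → x ≡ a ⊎ x ≡ b
∈-pair (here x≡a) = inj₁ x≡a
∈-pair (there (here x≡b)) = inj₂ x≡b
∈-pair (there (there ()))

triple : ∀ {A : Set} → A → A → A → Fin 3 → A
triple a b d 0F = a
triple a b d 1F = b
triple a b d 2F = d

triple-injective : ∀ {A : Set} {a b d : A} → a ≢ b → a ≢ d → b ≢ d → Injective _≡_ _≡_ (triple a b d)
triple-injective a≢b a≢d b≢d {0F} {0F} _ = refl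
triple-injective a≢b a≢d b≢d {0F} {1F} a≡b = ⊥-elim (a≢b a≡b)
triple-injective a≢b a≢d b≢d {0F} {2F} a≡d = ⊥-elim (a≢d a≡d)
triple-injective a≢b a≢d b≢d {1F} {0F} b≡a = ⊥-elim (a≢b (sym b≡a))
triple-injective a≢b a≢d b≢d {1F} {1F} _ = refl
triple-injective a≢b a≢d b≢d {1F} {2F} b≡d = ⊥-elim (b≢d b≡d)
triple-injective a≢b a≢d b≢d {2F} {0F} d≡a = ⊥-elim (a≢d (sym d≡a))
triple-injective a≢b a≢d b≢d {2F} {1F} d≡b = ⊥-elim (b≢d (sym d≡b))
triple-injective a≢b a≢d b≢d {2F} {2F} _ = refl

⟨$⟩ʳ-injective : ∀ {m} (π : Permutation′ m) → Injective _≡_ _≡_ (π ⟨$⟩ʳ_)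
⟨$⟩ʳ-injective π = Injection.injective (↔⇒↣ π)

successor⇒punchIn : ∀ {n ℓ} {R : Rel (Fin (ℕ.suc n)) ℓ} →
                    (∀ i → ∃ λ j → j ≢ i × R i j) → ∀ i → ∃ λ (j : Fin n) → R i (punchIn i j)
successor⇒punchIn {R = R} successor i with successor i
... | j , j≢i , r = punchOut (j≢i ∘ sym) , subst (R i) (sym (punchIn-punchOut (j≢i ∘ sym))) r

fixpoint-free⇒nontrivial-permutation : ∀ {ℓ} {R : Rel (Fin 3) ℓ} → Reflexive R →
  (∀ i → ∃ λ j → j ≢ i × R i j) →
  ∃ λ (σ : Permutation′ 3) → (∀ i → R i (σ ⟨$⟩ʳ i)) × ∃ λ i → σ ⟨$⟩ʳ i ≢ i
fixpoint-free⇒nontrivial-permutation R-refl successor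
  with successor⇒punchIn successor 0F | successor⇒punchIn successor 1F | successor⇒punchIn successor 2F
... | 0F , r₀₁ | 0F , r₁₀ | _ =
  transpose 0F 1F , (λ { 0F → r₀₁ ; 1F → r₁₀ ; 2F → R-refl }) , 0F , λ ()
... | 0F , r₀₁ | 1F , r₁₂ | 0F , r₂₀ =
  transpose 1F 2F ∘ₚ transpose 0F 1F , (λ { 0F → r₀₁ ; 1F → r₁₂ ; 2F → r₂₀ }) , 0F , λ ()
... | 0F , _ | 1F , r₁₂ | 1F , r₂₁ =
  transpose 1F 2F , (λ { 0F → R-refl ; 1F → r₁₂ ; 2F → r₂₁ }) , 1F , λ ()
... | 1F , r₀₂ | _ | 0F , r₂₀ =
  transpose 0F 2F , (λ { 0F → r₀₂ ; 1F → R-refl ; 2F → r₂₀ }) , 0F , λ ()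
... | 1F , r₀₂ | 0F , r₁₀ | 1F , r₂₁ =
  transpose 0F 1F ∘ₚ transpose 1F 2F , (λ { 0F → r₀₂ ; 1F → r₁₀ ; 2F → r₂₁ }) , 0F , λ ()
... | 1F , _ | 1F , r₁₂ | 1F , r₂₁ =
  transpose 1F 2F , (λ { 0F → R-refl ; 1F → r₁₂ ; 2F → r₂₁ }) , 1F , λ ()

module Triangle {A : Set} (_≟ᴬ_ : DecidableEquality A) where

  record ListColoredTriangle : Set where
    field
      Λ : Fin 3 → List A
      x : Fin 3 → A
      x-injective : Injective _≡_ _≡_ x
      x∈Λ : ∀ i → x i ∈ Λ i
      others : ∀ i → TwoOthers (Λ i) (x i)

  module _ (T : ListColoredTriangle) where
    open ListColoredTriangle T

    Free : A → Set
    Free p = ∀ i → p ≢ x i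

    Accepts : Fin 3 → Fin 3 → Set
    Accepts i j = x j ∈ Λ i

    HasFree : Fin 3 → Set
    HasFree i = ∃ λ p → p ∈ Λ i × Free p

    HasTwoFree : Fin 3 → Set
    HasTwoFree i = ∃₂ λ p q → p ∈ Λ i × q ∈ Λ i × p ≢ q × Free p × Free q

    record Recoloring : Set where
      field
        y : Fin 3 → A
        y-injective : Injective _≡_ _≡_ y
        y∈Λ : ∀ i → y i ∈ Λ i
        moved : ∃ λ i → y i ≢ x i
        -- the two ways y extends over vertices whose lists are their own color plus two colors of x
        reuse : (∀ i → ∃ λ j → y i ≡ x j) ⊎ (∃ λ k → ∀ i j → y i ≡ x j → j ≡ k)

    index-≢ : ∀ {p m j} → p ≡ x m → p ≢ x j → m ≢ j
    index-≢ p≡xm p≢xj m≡j = p≢xj (trans p≡xm (cong x m≡j))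

    free-or-used : ∀ p → Free p ⊎ ∃ λ j → p ≡ x j
    free-or-used p with any? (λ j → p ≟ᴬ x j)
    ... | yes used = inj₂ used
    ... | no unused = inj₁ λ j p≡xj → unused (j , p≡xj)

    hasTwoFree-or-accepts : ∀ i → HasTwoFree i ⊎ ∃ λ j → j ≢ i × Accepts i j
    hasTwoFree-or-accepts i with others i
    ... | twoOthers a b a∈ b∈ a≢b a≢x b≢x with free-or-used a | free-or-used b
    ...   | inj₂ (j , a≡xj) | _ = inj₂ (j , index-≢ a≡xj a≢x , subst (_∈ Λ i) a≡xj a∈)
    ...   | inj₁ _ | inj₂ (j , b≡xj) = inj₂ (j , index-≢ b≡xj b≢x , subst (_∈ Λ i) b≡xj b∈)
    ...   | inj₁ free-a | inj₁ free-b = inj₁ (a , b , a∈ , b∈ , a≢b , free-a , free-b)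

    accepts-or-hasFree : ∀ {i j k} → (∀ {m} → m ≢ j → m ≢ k → m ≡ i) → Accepts j k ⊎ HasFree j
    accepts-or-hasFree {i} {j} {k} third with others j
    ... | twoOthers a b a∈ b∈ a≢b a≢x b≢x with free-or-used a | free-or-used b
    ...   | inj₁ free-a | _ = inj₂ (a , a∈ , free-a)
    ...   | inj₂ _ | inj₁ free-b = inj₂ (b , b∈ , free-b)
    ...   | inj₂ (m , a≡xm) | inj₂ (m′ , b≡xm′) with m ≟ k | m′ ≟ k
    ...     | yes refl | _ = inj₁ (subst (_∈ Λ j) a≡xm a∈)
    ...     | no _ | yes refl = inj₁ (subst (_∈ Λ j) b≡xm′ b∈)
    ...     | no m≢k | no m′≢k =
      ⊥-elim (a≢b (trans a≡xm (trans (cong x (trans m≡i (sym m′≡i))) (sym b≡xm′))))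
      where
      m≡i : m ≡ i
      m≡i = third (index-≢ a≡xm a≢x) m≢k
      m′≡i : m′ ≡ i
      m′≡i = third (index-≢ b≡xm′ b≢x) m′≢k

    permuted : (σ : Permutation′ 3) → (∀ i → Accepts i (σ ⟨$⟩ʳ i)) → ∃ (λ i → σ ⟨$⟩ʳ i ≢ i) → Recoloring
    permuted σ accepted (i , σi≢i) = record
      { y = x ∘ (σ ⟨$⟩ʳ_)
      ; y-injective = ⟨$⟩ʳ-injective σ ∘ x-injective
      ; y∈Λ = accepted
      ; moved = i , σi≢i ∘ x-injective
      ; reuse = inj₁ λ i → σ ⟨$⟩ʳ i , refl
      }

    free-pair₀₁ : ∀ {p q} → p ∈ Λ 0F → q ∈ Λ 1F → p ≢ q → Free p → Free q → Recoloring
    free-pair₀₁ {p} {q} p∈ q∈ p≢q free-p free-q = record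
      { y = triple p q (x 2F)
      ; y-injective = triple-injective p≢q (free-p 2F) (free-q 2F)
      ; y∈Λ = λ { 0F → p∈ ; 1F → q∈ ; 2F → x∈Λ 2F }
      ; moved = 0F , free-p 0F
      ; reuse = inj₂ (2F , only-2F)
      }
      where
      only-2F : ∀ i j → triple p q (x 2F) i ≡ x j → j ≡ 2F
      only-2F 0F j p≡xj = ⊥-elim (free-p j p≡xj)
      only-2F 1F j q≡xj = ⊥-elim (free-q j q≡xj)
      only-2F 2F j x2≡xj = sym (x-injective x2≡xj)

  open ListColoredTriangle
  open Recoloring

  relabel : ListColoredTriangle → Permutation′ 3 → ListColoredTriangle
  relabel T π = record
    { Λ = Λ T ∘ (π ⟨$⟩ʳ_)
    ; x = x T ∘ (π ⟨$⟩ʳ_)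
    ; x-injective = ⟨$⟩ʳ-injective π ∘ x-injective T
    ; x∈Λ = x∈Λ T ∘ (π ⟨$⟩ʳ_)
    ; others = others T ∘ (π ⟨$⟩ʳ_)
    }

  module _ (T : ListColoredTriangle) (π : Permutation′ 3) where

    relabel-Free : ∀ {p} → Free T p → Free (relabel T π) p
    relabel-Free free-p i = free-p (π ⟨$⟩ʳ i)

    relabel-HasTwoFree : ∀ i → HasTwoFree T (π ⟨$⟩ʳ i) → HasTwoFree (relabel T π) i
    relabel-HasTwoFree _ (p , q , p∈ , q∈ , p≢q , free-p , free-q) =
      p , q , p∈ , q∈ , p≢q , relabel-Free free-p , relabel-Free free-q

    unrelabel : Recoloring (relabel T π) → Recoloring T
    unrelabel r = record
      { y = y r ∘ (π ⟨$⟩ˡ_)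
      ; y-injective = ⟨$⟩ʳ-injective (flip π) ∘ y-injective r
      ; y∈Λ = λ i → subst (λ j → y r (π ⟨$⟩ˡ i) ∈ Λ T j) (inverseʳ π) (y∈Λ r (π ⟨$⟩ˡ i))
      ; moved = moved-back (moved r)
      ; reuse = Sum.map reuse-all reuse-one (reuse r)
      }
      where
      moved-back : ∃ (λ i → y r i ≢ x T (π ⟨$⟩ʳ i)) → ∃ λ i → y r (π ⟨$⟩ˡ i) ≢ x T i
      moved-back (i , yi≢xπi) = π ⟨$⟩ʳ i , subst (λ j → y r j ≢ x T (π ⟨$⟩ʳ i)) (sym (inverseˡ π)) yi≢xπi

      reuse-all : (∀ i → ∃ λ j → y r i ≡ x T (π ⟨$⟩ʳ j)) → ∀ i → ∃ λ j → y r (π ⟨$⟩ˡ i) ≡ x T j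
      reuse-all uses i = π ⟨$⟩ʳ proj₁ (uses (π ⟨$⟩ˡ i)) , proj₂ (uses (π ⟨$⟩ˡ i))

      reuse-one : (∃ λ k → ∀ i j → y r i ≡ x T (π ⟨$⟩ʳ j) → j ≡ k) →
                  ∃ λ k → ∀ i j → y r (π ⟨$⟩ˡ i) ≡ x T j → j ≡ k
      reuse-one (k , only-k) = π ⟨$⟩ʳ k , λ i j yπ⁻¹i≡xj →
        trans (sym (inverseʳ π))
              (cong (π ⟨$⟩ʳ_) (only-k (π ⟨$⟩ˡ i) (π ⟨$⟩ˡ j) (trans yπ⁻¹i≡xj (cong (x T) (sym (inverseʳ π))))))

  hasTwoFree₀-recoloring : (T : ListColoredTriangle) → HasTwoFree T 0F → Recoloring T
  hasTwoFree₀-recoloring T (p , q , p∈ , q∈ , p≢q , free-p , free-q) =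
    from-others (accepts-or-hasFree T only-0F) (accepts-or-hasFree T (λ m≢2 m≢1 → only-0F m≢1 m≢2))
    where
    only-0F : ∀ {m : Fin 3} → m ≢ 1F → m ≢ 2F → m ≡ 0F
    only-0F {0F} _ _ = refl
    only-0F {1F} m≢1 _ = ⊥-elim (m≢1 refl)
    only-0F {2F} _ m≢2 = ⊥-elim (m≢2 refl)

    partner : ∀ r → ∃ λ d → (d ∈ Λ T 0F × Free T d) × d ≢ r
    partner = one-of-two-avoids _≟ᴬ_ (p∈ , free-p) (q∈ , free-q) p≢q

    τ : Permutation′ 3
    τ = transpose 1F 2F

    from-others : Accepts T 1F 2F ⊎ HasFree T 1F → Accepts T 2F 1F ⊎ HasFree T 2F → Recoloring T
    from-others (inj₂ (r , r∈ , free-r)) _ with partner r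
    ... | d , (d∈ , free-d) , d≢r = free-pair₀₁ T d∈ r∈ d≢r free-d free-r
    from-others _ (inj₂ (r , r∈ , free-r)) with partner r
    ... | d , (d∈ , free-d) , d≢r =
      unrelabel T τ (free-pair₀₁ (relabel T τ) d∈ r∈ d≢r (relabel-Free T τ free-d) (relabel-Free T τ free-r))
    from-others (inj₁ a₁₂) (inj₁ a₂₁) =
      permuted T τ (λ { 0F → x∈Λ T 0F ; 1F → a₁₂ ; 2F → a₂₁ }) (1F , λ ())

  recolor : (T : ListColoredTriangle) → Recoloring T
  recolor T with hasTwoFree-or-accepts T 0F | hasTwoFree-or-accepts T 1F | hasTwoFree-or-accepts T 2F
  ... | inj₁ two-free₀ | _ | _ = hasTwoFree₀-recoloring T two-free₀
  ... | _ | inj₁ two-free₁ | _ =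
    unrelabel T π (hasTwoFree₀-recoloring (relabel T π) (relabel-HasTwoFree T π 0F two-free₁))
    where π = transpose 0F 1F
  ... | _ | _ | inj₁ two-free₂ =
    unrelabel T π (hasTwoFree₀-recoloring (relabel T π) (relabel-HasTwoFree T π 0F two-free₂))
    where π = transpose 0F 2F
  ... | inj₂ a₀ | inj₂ a₁ | inj₂ a₂
    with fixpoint-free⇒nontrivial-permutation {R = Accepts T} (λ {i} → x∈Λ T i) (λ { 0F → a₀ ; 1F → a₁ ; 2F → a₂ })
  ...   | σ , accepted , σ-moves = permuted T σ accepted σ-moves

module _ {s : ℕ} where

  apex : Fin 3 → Fin (3 ℕ.+ s)
  apex i = i ↑ˡ s

  base : Fin s → Fin (3 ℕ.+ s)
  base e = 3 ↑ʳ e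

  data K111s-Vertex : Fin (3 ℕ.+ s) → Set where
    is-apex : ∀ i → K111s-Vertex (apex i)
    is-base : ∀ e → K111s-Vertex (base e)

  vertex : ∀ v → K111s-Vertex v
  vertex 0F = is-apex 0F
  vertex 1F = is-apex 1F
  vertex 2F = is-apex 2F
  vertex (suc (suc (suc e))) = is-base e

  part-apex : ∀ i → part {s} (apex i) ≡ toℕ i
  part-apex 0F = refl
  part-apex 1F = refl
  part-apex 2F = refl

  part-base : ∀ e → part {s} (base e) ≡ 3
  part-base e = cong (3 ℕ.+_) (⊓-zeroʳ (toℕ e))

  apexes-adjacent : ∀ {i j} → i ≢ j → K111s-Adj s (apex i) (apex j)
  apexes-adjacent {i} {j} i≢j same-part =
    i≢j (toℕ-injective (trans (sym (part-apex i)) (trans same-part (part-apex j))))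

  base-apex-adjacent : ∀ e i → K111s-Adj s (base e) (apex i)
  base-apex-adjacent e i same-part =
    <-irrefl (trans (sym (part-apex i)) (trans (sym same-part) (part-base e))) (toℕ<n i)

  bases-nonadjacent : ∀ e e′ → ¬ K111s-Adj s (base e) (base e′)
  bases-nonadjacent e e′ adj = adj (trans (part-base e) (sym (part-base e′)))

  joined-isLColoring : ∀ {L} (t : Fin 3 → Color) (g : Fin s → Color) →
                       Injective _≡_ _≡_ t → (∀ e i → g e ≢ t i) →
                       (∀ i → t i ∈ L (apex i)) → (∀ e → g e ∈ L (base e)) →
                       IsLColoring (K111s s) L (t ++ g)
  joined-isLColoring {L} t g t-injective g≢t t∈L g∈L = t++g∈L , t++g-proper
    where
    t++g∈L : ∀ v → (t ++ g) v ∈ L v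
    t++g∈L v with vertex v
    ... | is-apex i = subst (_∈ L (apex i)) (sym (lookup-++ˡ t g i)) (t∈L i)
    ... | is-base e = g∈L e

    t++g-proper : ∀ u v → K111s-Adj s u v → (t ++ g) u ≢ (t ++ g) v
    t++g-proper u v adj with vertex u | vertex v
    ... | is-apex i | is-apex j rewrite lookup-++ˡ t g i | lookup-++ˡ t g j =
      λ ti≡tj → adj (cong (part ∘ apex) (t-injective ti≡tj))
    ... | is-apex i | is-base e rewrite lookup-++ˡ t g i = λ ti≡ge → g≢t e i (sym ti≡ge)
    ... | is-base e | is-apex i rewrite lookup-++ˡ t g i = g≢t e i
    ... | is-base e | is-base e′ = ⊥-elim (bases-nonadjacent e e′ adj)

open Triangle ℕ._≟_

module _ {s : ℕ} {L : Fin (3 ℕ.+ s) → List Color} {c : Fin (3 ℕ.+ s) → Color}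
         (three-lists : IsKListAssignment (K111s s) 3 L) (c-unique : IsUniqueLColoring (K111s s) L c) where

  private
    c∈L : ∀ v → c v ∈ L v
    c∈L = proj₁ (proj₁ c-unique)

    c-proper : ∀ u v → K111s-Adj s u v → c u ≢ c v
    c-proper = proj₂ (proj₁ c-unique)

    others-at : ∀ v → TwoOthers (L v) (c v)
    others-at v = three-distinct⇒twoOthers (proj₁ (three-lists v)) (proj₂ (three-lists v)) (c∈L v)

  apex-triangle : ListColoredTriangle
  apex-triangle = record
    { Λ = L ∘ apex
    ; x = c ∘ apex
    ; x-injective = apex-colors-injective
    ; x∈Λ = c∈L ∘ apex
    ; others = others-at ∘ apex
    }
    where
    apex-colors-injective : Injective _≡_ _≡_ (c ∘ apex)
    apex-colors-injective {i} {j} ci≡cj with i ≟ j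
    ... | yes i≡j = i≡j
    ... | no i≢j = ⊥-elim (c-proper (apex i) (apex j) (apexes-adjacent i≢j) ci≡cj)

  base-list⊆apex-colors : ∀ e {a} → a ∈ L (base e) → a ≢ c (base e) → ∃ λ j → a ≡ c (apex j)
  base-list⊆apex-colors e {a} a∈ a≢ with any? (λ j → a ℕ.≟ c (apex j))
  ... | yes used = used
  ... | no unused = ⊥-elim (a≢ (unblocked-color-is-chosen {K111s s} c-unique a∈ unblocked))
    where
    unblocked : Unblocked (K111s s) c (base e) a
    unblocked u adj with vertex u
    ... | is-apex j = λ cj≡a → unused (j , sym cj≡a)
    ... | is-base e′ = ⊥-elim (bases-nonadjacent e′ e adj)

  apex-color-avoiding : ∀ k e → ∃ λ a → (a ∈ L (base e) × ∃ λ j → a ≡ c (apex j)) × a ≢ c (apex k)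
  apex-color-avoiding k e with others-at (base e)
  ... | twoOthers a b a∈ b∈ a≢b a≢x b≢x =
    one-of-two-avoids ℕ._≟_ (a∈ , base-list⊆apex-colors e a∈ a≢x) (b∈ , base-list⊆apex-colors e b∈ b≢x)
                      a≢b (c (apex k))

  module _ (r : Recoloring apex-triangle) where
    open Recoloring r

    no-base-colors-avoiding-y : ¬ (∀ e → ∃ λ a → a ∈ L (base e) × ∀ i → a ≢ y i)
    no-base-colors-avoiding-y base-color with moved
    ... | i , yi≢ci = yi≢ci (trans (sym (lookup-++ˡ y g i)) (proj₂ c-unique (y ++ g) second (apex i)))
      where
      g : Fin s → Color
      g = proj₁ ∘ base-color

      second : IsLColoring (K111s s) L (y ++ g)
      second = joined-isLColoring y g y-injective (proj₂ ∘ proj₂ ∘ base-color) y∈Λ (proj₁ ∘ proj₂ ∘ base-color)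

    recoloring-impossible : ⊥
    recoloring-impossible with reuse
    ... | inj₁ uses-apex-colors = no-base-colors-avoiding-y λ e → c (base e) , c∈L (base e) , base≢y e
      where
      base≢y : ∀ e i → c (base e) ≢ y i
      base≢y e i cb≡yi with uses-apex-colors i
      ... | j , yi≡cj = c-proper (base e) (apex j) (base-apex-adjacent e j) (trans cb≡yi yi≡cj)
    ... | inj₂ (k , only-k) = no-base-colors-avoiding-y avoiding
      where
      avoiding : ∀ e → ∃ λ a → a ∈ L (base e) × ∀ i → a ≢ y i
      avoiding e with apex-color-avoiding k e
      ... | a , (a∈ , j , a≡cj) , a≢ck =
        a , a∈ , λ i a≡yi → a≢ck (subst (λ m → a ≡ c (apex m)) (only-k i j (trans (sym a≡yi) a≡cj)) a≡cj)

K111s-propM3 : ∀ s → PropM (K111s s) 3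
K111s-propM3 s (L , three-lists , c , c-unique) =
  recoloring-impossible three-lists c-unique (recolor (apex-triangle three-lists c-unique))

uniquely-1-list-colorable : ∀ G → UniquelyListColorable G 1
uniquely-1-list-colorable G =
  (λ v → toℕ v ∷ []) , (λ _ → refl , [] ∷ []) , toℕ , ((λ _ → here refl) , toℕ-proper) ,
  λ _ (c′∈L , _) v → singleton⁻ (c′∈L v)
  where
  toℕ-proper : ∀ u v → Adj G u v → toℕ u ≢ toℕ v
  toℕ-proper u v adj eq = irrefl G (subst (Adj G u) (sym (toℕ-injective eq)) adj)

module _ (s : ℕ) where
  private
    L₂ : Fin (3 ℕ.+ (2 ℕ.+ s)) → List Color
    L₂ 0F = 0 ∷ 1 ∷ []
    L₂ 1F = 0 ∷ 2 ∷ []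
    L₂ 2F = 0 ∷ 3 ∷ []
    L₂ (suc (suc (suc 0F))) = 0 ∷ 1 ∷ []
    L₂ (suc (suc (suc (suc _)))) = 0 ∷ 2 ∷ []

    two-lists : IsKListAssignment (K111s (2 ℕ.+ s)) 2 L₂
    two-lists 0F = refl , ((λ ()) ∷ []) ∷ [] ∷ []
    two-lists 1F = refl , ((λ ()) ∷ []) ∷ [] ∷ []
    two-lists 2F = refl , ((λ ()) ∷ []) ∷ [] ∷ []
    two-lists (suc (suc (suc 0F))) = refl , ((λ ()) ∷ []) ∷ [] ∷ []
    two-lists (suc (suc (suc (suc _)))) = refl , ((λ ()) ∷ []) ∷ [] ∷ []

    c₂ : Fin (3 ℕ.+ (2 ℕ.+ s)) → Color
    c₂ = triple 1 2 3 ++ const 0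

    c₂-isLColoring : IsLColoring (K111s (2 ℕ.+ s)) L₂ c₂
    c₂-isLColoring =
      joined-isLColoring (triple 1 2 3) (const 0) (triple-injective (λ ()) (λ ()) (λ ()))
        (λ _ → λ { 0F () ; 1F () ; 2F () })
        (λ { 0F → there (here refl) ; 1F → there (here refl) ; 2F → there (here refl) })
        (λ { 0F → here refl ; (suc _) → here refl })

    c₂-unique : ∀ c′ → IsLColoring (K111s (2 ℕ.+ s)) L₂ c′ → ∀ v → c′ v ≡ c₂ v
    c₂-unique c′ (c′∈L , c′-proper) = forced
      where
      base-apex-clash : ∀ (e : Fin (2 ℕ.+ s)) i {k} → c′ (base e) ≡ k → c′ (apex i) ≡ k → ⊥
      base-apex-clash e i be≡k ai≡k =
        c′-proper (base e) (apex i) (base-apex-adjacent e i) (trans be≡k (sym ai≡k))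

      apex₀ : c′ (apex 0F) ≡ 1
      apex₀ with ∈-pair (c′∈L (apex 0F))
      ... | inj₂ a₀≡1 = a₀≡1
      ... | inj₁ a₀≡0 with ∈-pair (c′∈L (base 1F)) | ∈-pair (c′∈L (apex 1F))
      ...   | inj₁ b₁≡0 | _ = ⊥-elim (base-apex-clash 1F 0F b₁≡0 a₀≡0)
      ...   | _ | inj₁ a₁≡0 = ⊥-elim (c′-proper (apex 1F) (apex 0F) (λ ()) (trans a₁≡0 (sym a₀≡0)))
      ...   | inj₂ b₁≡2 | inj₂ a₁≡2 = ⊥-elim (base-apex-clash 1F 1F b₁≡2 a₁≡2)

      apex-not-0 : ∀ {i} → c′ (apex i) ≢ 0
      apex-not-0 {i} ai≡0 with ∈-pair (c′∈L (base 0F))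
      ... | inj₁ b₀≡0 = base-apex-clash 0F i b₀≡0 ai≡0
      ... | inj₂ b₀≡1 = base-apex-clash 0F 0F b₀≡1 apex₀

      apex₁ : c′ (apex 1F) ≡ 2
      apex₁ with ∈-pair (c′∈L (apex 1F))
      ... | inj₁ a₁≡0 = ⊥-elim (apex-not-0 a₁≡0)
      ... | inj₂ a₁≡2 = a₁≡2

      apex₂ : c′ (apex 2F) ≡ 3
      apex₂ with ∈-pair (c′∈L (apex 2F))
      ... | inj₁ a₂≡0 = ⊥-elim (apex-not-0 a₂≡0)
      ... | inj₂ a₂≡3 = a₂≡3

      base-0 : ∀ e → c′ (base e) ≡ 0
      base-0 0F with ∈-pair (c′∈L (base 0F))
      ... | inj₁ b₀≡0 = b₀≡0
      ... | inj₂ b₀≡1 = ⊥-elim (base-apex-clash 0F 0F b₀≡1 apex₀)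
      base-0 (suc e) with ∈-pair (c′∈L (base (suc e)))
      ... | inj₁ b≡0 = b≡0
      ... | inj₂ b≡2 = ⊥-elim (base-apex-clash (suc e) 1F b≡2 apex₁)

      forced : ∀ v → c′ v ≡ c₂ v
      forced v with vertex v
      ... | is-apex 0F = apex₀
      ... | is-apex 1F = apex₁
      ... | is-apex 2F = apex₂
      ... | is-base e = base-0 e

  K111s[2+s]-uniquely-2-list-colorable : UniquelyListColorable (K111s (2 ℕ.+ s)) 2
  K111s[2+s]-uniquely-2-list-colorable = L₂ , two-lists , c₂ , c₂-isLColoring , c₂-unique

K111s-uniquely-2-list-colorable : ∀ {s} → 2 ≤ s → UniquelyListColorable (K111s s) 2
K111s-uniquely-2-list-colorable (s≤s (s≤s (z≤n {s}))) = K111s[2+s]-uniquely-2-list-colorable s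

proposition3p7 : (s : ℕ) → 2 ≤ s → IsMNumber (K111s s) 3
proposition3p7 s 2≤s = s≤s z≤n , K111s-propM3 s , not-M
  where
  not-M : ∀ k → 1 ≤ k → k ℕ.< 3 → ¬ PropM (K111s s) k
  not-M 1 _ _ M₁ = M₁ (uniquely-1-list-colorable (K111s s))
  not-M 2 _ _ M₂ = M₂ (K111s-uniquely-2-list-colorable 2≤s)
  not-M (ℕ.suc (ℕ.suc (ℕ.suc _))) _ (s≤s (s≤s (s≤s ())))
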